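{- Let $\lambda_1,\lambda_2,u,v\in\mathbb{Z}$ with $\gcd(u,v)=1$ and $v\mid(\lambda_1-\lambda_2)$, let $\Lambda=\operatorname{diag}(\lambda_1,\lambda_2)$, $M=\begin{pmatrix}1&u\\0&v\end{pmatrix}$, and assume $A=M\Lambda M^{ -1}\in\operatorname{M}_2(\mathbb{Z})$ is non-singular with $\mathcal{P}'\ne\emptyset$. Assume $\operatorname{rad}(\lambda_2)$ divides $\operatorname{rad}(\lambda_1)$. Then $T\in\operatorname{End}(G_A)$ if and only if $$T=\begin{pmatrix}x&y\\0&z\end{pmatrix}\in\operatorname{M}_2(\mathcal{R}),\quad z\in\mathbb{Z}[\lambda_2^{ -1}].$$ In particular, $\operatorname{End}(G_A)$ is not commutative and does not lie inside the centralizer of $A$ in $\operatorname{M}_2(\mathcal{R})$.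
   Context: $G_A=\{A^k\mathbf{x}\mid\mathbf{x}\in\mathbb{Z}^2,k\in\mathbb{Z}\}\subseteq\mathbb{Q}^2$; $\operatorname{End}(G_A)$ is identified with the set of $T\in\operatorname{M}_2(\mathbb{Q})$ with $T(G_A)\subseteq G_A$. $\mathcal{R}=\mathbb{Z}[1/\det A]$. $\mathcal{P}$ is the set of primes dividing $\det A$, $\mathcal{P}'=\{p\in\mathcal{P}\mid h_A\not\equiv x^2\pmod p\}$ with $h_A$ the characteristic polynomial of $A$. $\operatorname{rad}(m)$ is the product of the distinct primes dividing $m$. $\mathbb{Z}[\lambda^{ -1}]\subseteq\mathbb{Q}$ is the ring generated by $1/\lambda$. -}

module Defs where

open import Data.Nat as ℕ using (ℕ; zero; suc)
open import Data.Nat.Divisibility as ℕD using (_∣?_)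
open import Data.Nat.Primality using (Prime; prime?)
open import Data.Integer as ℤ using (ℤ; +_; -[1+_])
open import Data.Integer.Divisibility as ℤD using ()
open import Data.Rational as ℚ using (ℚ; 0ℚ; 1ℚ; 1/_)
open import Data.Rational.Properties as ℚP using ()
open import Data.List using (List; filter; upTo)
open import Data.Nat.ListAction using (product)
open import Data.Product using (Σ; _×_; _,_; ∃)
open import Relation.Nullary using (¬_; yes; no)
open import Relation.Nullary.Decidable using (_×-dec_)
open import Relation.Binary.PropositionalEquality using (_≡_)

fromℤ : ℤ → ℚ
fromℤ n = n ℚ./ 1

record M2 (X : Set) : Set where
  constructor mat
  field
    a b c d : X

open M2 public

V2 : Set → Set
V2 X = X × X

-- total reciprocal on ℚ (1/0 := 0; only ever used at nonzero arguments)
recip : ℚ → ℚ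
recip p with p ℚ.≟ 0ℚ
... | yes _ = 0ℚ
... | no p≢0 = 1/_ p {{ℚ.≢-nonZero p≢0}}

_*M_ : M2 ℚ → M2 ℚ → M2 ℚ
mat a b c d *M mat a' b' c' d' =
  mat (a ℚ.* a' ℚ.+ b ℚ.* c') (a ℚ.* b' ℚ.+ b ℚ.* d')
      (c ℚ.* a' ℚ.+ d ℚ.* c') (c ℚ.* b' ℚ.+ d ℚ.* d')

infixl 7 _*M_

_·_ : M2 ℚ → V2 ℚ → V2 ℚ
mat a b c d · (x , y) = (a ℚ.* x ℚ.+ b ℚ.* y , c ℚ.* x ℚ.+ d ℚ.* y)

idM : M2 ℚ
idM = mat 1ℚ 0ℚ 0ℚ 1ℚ

detQ : M2 ℚ → ℚ
detQ (mat a b c d) = a ℚ.* d ℚ.- b ℚ.* c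

-- inverse via adjugate / determinant (meaningful when det ≠ 0)
invM : M2 ℚ → M2 ℚ
invM m@(mat a b c d) =
  let r = recip (detQ m) in
  mat (r ℚ.* d) (r ℚ.* ℚ.- b) (r ℚ.* ℚ.- c) (r ℚ.* a)

powN : M2 ℚ → ℕ → M2 ℚ
powN m zero = idM
powN m (suc n) = m *M powN m n

powZ : M2 ℚ → ℤ → M2 ℚ
powZ m (+ n) = powN m n
powZ m -[1+ n ] = powN (invM m) (suc n)

embM : M2 ℤ → M2 ℚ
embM (mat a b c d) = mat (fromℤ a) (fromℤ b) (fromℤ c) (fromℤ d)

detZ : M2 ℤ → ℤ
detZ (mat a b c d) = a ℤ.* d ℤ.- b ℤ.* c

trZ : M2 ℤ → ℤ
trZ (mat a b c d) = a ℤ.+ d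

InG : M2 ℚ → V2 ℚ → Set
InG A w = Σ ℤ λ k → Σ (V2 ℤ) λ x →
  w ≡ powZ A k · (fromℤ (Data.Product.proj₁ x) , fromℤ (Data.Product.proj₂ x))

IsEnd : M2 ℚ → M2 ℚ → Set
IsEnd A T = ∀ w → InG A w → InG A (T · w)

powQ : ℚ → ℕ → ℚ
powQ q zero = 1ℚ
powQ q (suc n) = q ℚ.* powQ q n

InZInv : ℚ → ℚ → Set
InZInv r q = Σ ℤ λ n → Σ ℕ λ k → q ≡ fromℤ n ℚ.* powQ (recip r) k

record Quad : Set where
  constructor quad
  field
    c0 c1 c2 : ℤ

charPoly : M2 ℤ → Quad
charPoly A = quad (detZ A) (ℤ.- trZ A) (+ 1)

xSquared : Quad
xSquared = quad (+ 0) (+ 0) (+ 1)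

QuadCongMod : ℕ → Quad → Quad → Set
QuadCongMod p (quad a0 a1 a2) (quad b0 b1 b2) =
  ((+ p) ℤD.∣ (a0 ℤ.- b0)) × ((+ p) ℤD.∣ (a1 ℤ.- b1)) × ((+ p) ℤD.∣ (a2 ℤ.- b2))

P'NonEmpty : M2 ℤ → Set
P'NonEmpty A = ∃ λ p → Prime p × (+ p) ℤD.∣ detZ A × ¬ QuadCongMod p (charPoly A) xSquared

radℕ : ℕ → ℕ
radℕ n = product (filter (λ p → prime? p ×-dec (p ∣? n)) (upTo (suc n)))

rad : ℤ → ℕ
rad m = radℕ ℤ.∣ m ∣

module Submission where

-- M and Λ are upper triangular, so A = M Λ M⁻¹ is an integer matrix (λ₁ β ; 0 λ₂). All powers of
-- A and A⁻¹ are then upper triangular with entries in ℤ[1/λ₁λ₂] and lower right entry in ℤ[1/λ₂],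
-- so G_A ⊆ ℤ[1/λ₁λ₂] × ℤ[1/λ₂]. As rad λ₂ ∣ rad λ₁, λ₂ divides a power of λ₁, and applying A to a
-- vector of ℤ[1/λ₁] × ℤ[1/λ₂] often enough clears its denominators: G_A = ℤ[1/λ₁] × ℤ[1/λ₂].
-- Every upper triangular T of the stated shape therefore preserves G_A. Conversely, the columns
-- T e₁, T e₂ of an endomorphism lie in G_A, and since A⁻ⁿ e₁ = (λ₁⁻ⁿ, 0) ∈ G_A the lower left
-- entry c of T satisfies c λ₁⁻ⁿ ∈ ℤ[1/λ₂] for all n. A prime p ∈ 𝒫′ divides λ₁ but not λ₂
-- (otherwise h_A ≡ x² mod p), which forces c = 0. Finally E₁₁ and E₁₂ are non-commuting
-- endomorphisms, and E₁₂ commutes with A only if λ₁ = λ₂, which p rules out.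

open import Defs
open import Level using (0ℓ)
open import Algebra.Bundles using (CommutativeMonoid)
open import Data.Empty using (⊥-elim)
open import Data.List.Base using (_∷_; []; filter; upTo; length)
open import Data.List.Membership.Propositional using (_∈_)
open import Data.List.Membership.Propositional.Properties using (∈-upTo⁺)
open import Data.List.Relation.Unary.All using (All; []; _∷_)
open import Data.List.Relation.Unary.Any using (here; there)
open import Data.Maybe.Base using (Maybe; just; nothing)
open import Data.Nat as ℕ using (ℕ; zero; suc; _<_; z≤n; s≤s)
import Data.Nat.Properties as ℕP
open import Data.Nat.Divisibility as ℕD
  using ( _∣_; _∣?_; divides; ∣-refl; ∣-trans; 1∣_; m∣m*n; ∣n⇒∣m*n; *-pres-∣; *-monoʳ-∣; *-cancelˡ-∣
        ; ∣⇒≤; ∣1⇒≡1)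
open import Data.Nat.ListAction using (product)
open import Data.Nat.Primality using (Prime; prime?; euclidsLemma; prime⇒nonZero; prime⇒nonTrivial)
open import Data.Nat.Primality.Factorisation using (factorise; PrimeFactorisation)
open import Data.Integer as ℤ using (ℤ; +_; -[1+_])
import Data.Integer.Properties as ℤP
open import Data.Integer.GCD as ℤG using ()
open import Data.Integer.Divisibility as ℤD using ()
import Data.Integer.Divisibility.Signed as ℤS
open import Data.Rational as ℚ using (ℚ; 0ℚ; 1ℚ; _+_; _*_; -_; mkℚ)
import Data.Rational.Properties as ℚP
open import Data.Rational.Unnormalised as ℚᵘ using (mkℚᵘ; *≡*)
import Data.Rational.Unnormalised.Properties as ℚᵘP
open import Data.Product using (Σ; _×_; _,_; proj₁; proj₂; map₁)
open import Data.Sum using (inj₁; inj₂)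
open import Function.Bundles using (_⇔_; mk⇔; Equivalence)
open import Function.Construct.Composition using (_⇔-∘_)
open import Relation.Nullary using (¬_; yes; no; contradiction)
open import Relation.Nullary.Decidable using (_×-dec_)
open import Relation.Binary.PropositionalEquality
import Algebra.Properties.CommutativeSemigroup ℕP.*-commutativeSemigroup as ℕ*
import Algebra.Properties.CommutativeSemigroup ℤP.*-commutativeSemigroup as ℤ*
import Algebra.Properties.CommutativeSemigroup
  (CommutativeMonoid.commutativeSemigroup ℚP.*-1-commutativeMonoid) as ℚ*
import Tactic.RingSolver as RingSolver
import Tactic.RingSolver.Core.AlmostCommutativeRing as ACR

ℚ-ring : ACR.AlmostCommutativeRing 0ℓ 0ℓ
ℚ-ring = ACR.fromCommutativeRing ℚP.+-*-commutativeRing 0≟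
  where
  0≟ : (q : ℚ) → Maybe (0ℚ ≡ q)
  0≟ q with 0ℚ ℚ.≟ q
  ... | yes 0≡q = just 0≡q
  ... | no _    = nothing

toℚᵘ-fromℤ : ∀ z → ℚ.toℚᵘ (fromℤ z) ℚᵘ.≃ mkℚᵘ z 0
toℚᵘ-fromℤ z = ℚP.toℚᵘ-fromℚᵘ (mkℚᵘ z 0)

fromℤ-+ : ∀ i j → fromℤ (i ℤ.+ j) ≡ fromℤ i + fromℤ j
fromℤ-+ i j = ℚP.toℚᵘ-injective (begin
  ℚ.toℚᵘ (fromℤ (i ℤ.+ j))                ≈⟨ toℚᵘ-fromℤ (i ℤ.+ j) ⟩
  mkℚᵘ (i ℤ.+ j) 0                         ≈⟨ *≡* (cong (ℤ._* + 1) (sym i*1+j*1≡i+j)) ⟩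
  mkℚᵘ i 0 ℚᵘ.+ mkℚᵘ j 0                   ≈⟨ ℚᵘP.+-cong (toℚᵘ-fromℤ i) (toℚᵘ-fromℤ j) ⟨
  ℚ.toℚᵘ (fromℤ i) ℚᵘ.+ ℚ.toℚᵘ (fromℤ j)  ≈⟨ ℚP.toℚᵘ-homo-+ (fromℤ i) (fromℤ j) ⟨
  ℚ.toℚᵘ (fromℤ i + fromℤ j)               ∎)
  where
  open ℚᵘP.≃-Reasoning
  i*1+j*1≡i+j : i ℤ.* + 1 ℤ.+ j ℤ.* + 1 ≡ i ℤ.+ j
  i*1+j*1≡i+j = cong₂ ℤ._+_ (ℤP.*-identityʳ i) (ℤP.*-identityʳ j)

fromℤ-* : ∀ i j → fromℤ (i ℤ.* j) ≡ fromℤ i * fromℤ j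
fromℤ-* i j = ℚP.toℚᵘ-injective (begin
  ℚ.toℚᵘ (fromℤ (i ℤ.* j))                ≈⟨ toℚᵘ-fromℤ (i ℤ.* j) ⟩
  mkℚᵘ i 0 ℚᵘ.* mkℚᵘ j 0                   ≈⟨ ℚᵘP.*-cong (toℚᵘ-fromℤ i) (toℚᵘ-fromℤ j) ⟨
  ℚ.toℚᵘ (fromℤ i) ℚᵘ.* ℚ.toℚᵘ (fromℤ j)  ≈⟨ ℚP.toℚᵘ-homo-* (fromℤ i) (fromℤ j) ⟨
  ℚ.toℚᵘ (fromℤ i * fromℤ j)               ∎)
  where open ℚᵘP.≃-Reasoning

fromℤ-‿ : ∀ i → fromℤ (ℤ.- i) ≡ - fromℤ i
fromℤ-‿ i = ℚP.toℚᵘ-injective (begin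
  ℚ.toℚᵘ (fromℤ (ℤ.- i))     ≈⟨ toℚᵘ-fromℤ (ℤ.- i) ⟩
  ℚᵘ.- mkℚᵘ i 0               ≈⟨ ℚᵘP.-‿cong (toℚᵘ-fromℤ i) ⟨
  ℚᵘ.- ℚ.toℚᵘ (fromℤ i)      ≈⟨ ℚP.toℚᵘ-homo‿- (fromℤ i) ⟨
  ℚ.toℚᵘ (- fromℤ i)          ∎)
  where open ℚᵘP.≃-Reasoning

fromℤ-injective : ∀ {i j} → fromℤ i ≡ fromℤ j → i ≡ j
fromℤ-injective {i} {j} eq with ℚᵘP.≃-trans (ℚᵘP.≃-sym (toℚᵘ-fromℤ i))
                                 (ℚᵘP.≃-trans (ℚᵘP.≃-reflexive (cong ℚ.toℚᵘ eq)) (toℚᵘ-fromℤ j))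
... | *≡* i*1≡j*1 = trans (sym (ℤP.*-identityʳ i)) (trans i*1≡j*1 (ℤP.*-identityʳ j))

*-↧≡↥ : ∀ q → q * fromℤ (ℚ.↧ q) ≡ fromℤ (ℚ.↥ q)
*-↧≡↥ q@(mkℚ n d _) = ℚP.toℚᵘ-injective (begin
  ℚ.toℚᵘ (q * fromℤ (+ suc d))                 ≈⟨ ℚP.toℚᵘ-homo-* q (fromℤ (+ suc d)) ⟩
  mkℚᵘ n d ℚᵘ.* ℚ.toℚᵘ (fromℤ (+ suc d))      ≈⟨ ℚᵘP.*-congˡ {mkℚᵘ n d} (toℚᵘ-fromℤ (+ suc d)) ⟩
  mkℚᵘ n d ℚᵘ.* mkℚᵘ (+ suc d) 0               ≈⟨ *≡* (trans (ℤP.*-identityʳ _) (cong (n ℤ.*_) [1+d]≡[1+d]*1)) ⟩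
  mkℚᵘ n 0                                      ≈⟨ toℚᵘ-fromℤ n ⟨
  ℚ.toℚᵘ (fromℤ n)                             ∎)
  where
  open ℚᵘP.≃-Reasoning
  [1+d]≡[1+d]*1 : + suc d ≡ + (suc d ℕ.* 1)
  [1+d]≡[1+d]*1 = cong +_ (sym (ℕP.*-identityʳ (suc d)))

fromℤ-≢0 : ∀ {i} → i ≢ + 0 → fromℤ i ≢ 0ℚ
fromℤ-≢0 i≢0 i≡0 = i≢0 (fromℤ-injective i≡0)

recip-inverseʳ : ∀ q → q ≢ 0ℚ → q * recip q ≡ 1ℚ
recip-inverseʳ q q≢0 with q ℚ.≟ 0ℚ
... | yes q≡0 = ⊥-elim (q≢0 q≡0)
... | no q≢0′ = ℚP.*-inverseʳ q {{ℚ.≢-nonZero q≢0′}}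

powQ-fromℤ : ∀ i n → powQ (fromℤ i) n ≡ fromℤ (i ℤ.^ n)
powQ-fromℤ i zero    = refl
powQ-fromℤ i (suc n) = trans (cong (fromℤ i *_) (powQ-fromℤ i n)) (sym (fromℤ-* i (i ℤ.^ n)))

powQ-inverse : ∀ {s q} → s * q ≡ 1ℚ → ∀ n → powQ s n * powQ q n ≡ 1ℚ
powQ-inverse sq≡1 zero    = ℚP.*-identityˡ 1ℚ
powQ-inverse {s} {q} sq≡1 (suc n) = begin
  (s * powQ s n) * (q * powQ q n)   ≡⟨ ℚ*.interchange s (powQ s n) q (powQ q n) ⟩
  (s * q) * (powQ s n * powQ q n)   ≡⟨ cong₂ _*_ sq≡1 (powQ-inverse sq≡1 n) ⟩
  1ℚ * 1ℚ                           ≡⟨ ℚP.*-identityˡ 1ℚ ⟩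
  1ℚ                                ∎
  where open ≡-Reasoning

^-distribʳ-* : ∀ i j n → (i ℤ.* j) ℤ.^ n ≡ i ℤ.^ n ℤ.* j ℤ.^ n
^-distribʳ-* i j zero    = refl
^-distribʳ-* i j (suc n) =
  trans (cong ((i ℤ.* j) ℤ.*_) (^-distribʳ-* i j n)) (ℤ*.interchange i j (i ℤ.^ n) (j ℤ.^ n))

infix 4 _∈ℤ[1/_]

_∈ℤ[1/_] : ℚ → ℤ → Set
q ∈ℤ[1/ L ] = Σ ℕ λ k → Σ ℤ λ z → fromℤ (L ℤ.^ k) * q ≡ fromℤ z

ℤ[1/_]⊆ℤ[1/_] : ℤ → ℤ → Set
ℤ[1/ L ]⊆ℤ[1/ M ] = ∀ {q} → q ∈ℤ[1/ L ] → q ∈ℤ[1/ M ]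

fromℤ∈ℤ[1/] : ∀ L z → fromℤ z ∈ℤ[1/ L ]
fromℤ∈ℤ[1/] L z = 0 , z , ℚP.*-identityˡ (fromℤ z)

fromℤ-^-+ : ∀ L k l → fromℤ (L ℤ.^ (k ℕ.+ l)) ≡ fromℤ (L ℤ.^ k) * fromℤ (L ℤ.^ l)
fromℤ-^-+ L k l = trans (cong fromℤ (ℤP.^-distribˡ-+-* L k l)) (fromℤ-* (L ℤ.^ k) (L ℤ.^ l))

module _ {L : ℤ} where

  ∈ℤ[1/]-+ : ∀ {p q} → p ∈ℤ[1/ L ] → q ∈ℤ[1/ L ] → p + q ∈ℤ[1/ L ]
  ∈ℤ[1/]-+ {p} {q} (k , m , Pp≡m) (l , n , Rq≡n) = k ℕ.+ l , L ℤ.^ l ℤ.* m ℤ.+ L ℤ.^ k ℤ.* n , (begin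
    fromℤ (L ℤ.^ (k ℕ.+ l)) * (p + q)   ≡⟨ cong (_* (p + q)) (fromℤ-^-+ L k l) ⟩
    (P * R) * (p + q)                    ≡⟨ distribute P R p q ⟩
    R * (P * p) + P * (R * q)            ≡⟨ cong₂ (λ s t → R * s + P * t) Pp≡m Rq≡n ⟩
    R * fromℤ m + P * fromℤ n            ≡⟨ cong₂ _+_ (fromℤ-* (L ℤ.^ l) m) (fromℤ-* (L ℤ.^ k) n) ⟨
    fromℤ (L ℤ.^ l ℤ.* m) + fromℤ (L ℤ.^ k ℤ.* n)   ≡⟨ fromℤ-+ (L ℤ.^ l ℤ.* m) (L ℤ.^ k ℤ.* n) ⟨
    fromℤ (L ℤ.^ l ℤ.* m ℤ.+ L ℤ.^ k ℤ.* n)         ∎)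
    where
    open ≡-Reasoning
    P R : ℚ
    P = fromℤ (L ℤ.^ k)
    R = fromℤ (L ℤ.^ l)
    distribute : ∀ P R p q → (P * R) * (p + q) ≡ R * (P * p) + P * (R * q)
    distribute = RingSolver.solve-∀ ℚ-ring

  ∈ℤ[1/]-* : ∀ {p q} → p ∈ℤ[1/ L ] → q ∈ℤ[1/ L ] → p * q ∈ℤ[1/ L ]
  ∈ℤ[1/]-* {p} {q} (k , m , Pp≡m) (l , n , Rq≡n) = k ℕ.+ l , m ℤ.* n , (begin
    fromℤ (L ℤ.^ (k ℕ.+ l)) * (p * q)   ≡⟨ cong (_* (p * q)) (fromℤ-^-+ L k l) ⟩
    (P * R) * (p * q)                    ≡⟨ ℚ*.interchange P R p q ⟩
    (P * p) * (R * q)                    ≡⟨ cong₂ _*_ Pp≡m Rq≡n ⟩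
    fromℤ m * fromℤ n                    ≡⟨ fromℤ-* m n ⟨
    fromℤ (m ℤ.* n)                      ∎)
    where
    open ≡-Reasoning
    P R : ℚ
    P = fromℤ (L ℤ.^ k)
    R = fromℤ (L ℤ.^ l)

∣^⇒ℤ[1/]⊆ : ∀ {L M} j → L ℤS.∣ M ℤ.^ j → ℤ[1/ L ]⊆ℤ[1/ M ]
∣^⇒ℤ[1/]⊆ {L} {M} j (ℤS.divides e M^j≡eL) {q} (k , z , Pq≡z) = j ℕ.* k , e ℤ.^ k ℤ.* z , (begin
  fromℤ (M ℤ.^ (j ℕ.* k)) * q            ≡⟨ cong (λ t → fromℤ t * q) M^jk≡e^kL^k ⟩
  fromℤ (e ℤ.^ k ℤ.* L ℤ.^ k) * q        ≡⟨ cong (_* q) (fromℤ-* (e ℤ.^ k) (L ℤ.^ k)) ⟩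
  (fromℤ (e ℤ.^ k) * P) * q              ≡⟨ ℚP.*-assoc (fromℤ (e ℤ.^ k)) P q ⟩
  fromℤ (e ℤ.^ k) * (P * q)              ≡⟨ cong (fromℤ (e ℤ.^ k) *_) Pq≡z ⟩
  fromℤ (e ℤ.^ k) * fromℤ z              ≡⟨ fromℤ-* (e ℤ.^ k) z ⟨
  fromℤ (e ℤ.^ k ℤ.* z)                  ∎)
  where
  open ≡-Reasoning
  P : ℚ
  P = fromℤ (L ℤ.^ k)
  M^jk≡e^kL^k : M ℤ.^ (j ℕ.* k) ≡ e ℤ.^ k ℤ.* L ℤ.^ k
  M^jk≡e^kL^k = trans (sym (ℤP.^-*-assoc M j k)) (trans (cong (ℤ._^ k) M^j≡eL) (^-distribʳ-* e L k))

∈ℤ[1/]⇔InZInv : ∀ {L} → L ≢ + 0 → ∀ q → q ∈ℤ[1/ L ] ⇔ InZInv (fromℤ L) q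
∈ℤ[1/]⇔InZInv {L} L≢0 q = mk⇔
  (λ (k , z , Pq≡z) → z , k , (begin
    q                  ≡⟨ ℚP.*-identityˡ q ⟨
    1ℚ * q             ≡⟨ cong (_* q) (P*R≡1 k) ⟨
    (P k * R k) * q    ≡⟨ ℚ*.xy∙z≈xz∙y (P k) (R k) q ⟩
    (P k * q) * R k    ≡⟨ cong (_* R k) Pq≡z ⟩
    fromℤ z * R k      ∎))
  (λ (z , k , q≡zR) → k , z , (begin
    P k * q                 ≡⟨ cong (P k *_) q≡zR ⟩
    P k * (fromℤ z * R k)   ≡⟨ ℚ*.x∙yz≈y∙xz (P k) (fromℤ z) (R k) ⟩
    fromℤ z * (P k * R k)   ≡⟨ cong (fromℤ z *_) (P*R≡1 k) ⟩
    fromℤ z * 1ℚ            ≡⟨ ℚP.*-identityʳ (fromℤ z) ⟩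
    fromℤ z                 ∎))
  where
  open ≡-Reasoning
  P R : ℕ → ℚ
  P k = fromℤ (L ℤ.^ k)
  R k = powQ (recip (fromℤ L)) k
  P*R≡1 : ∀ k → P k * R k ≡ 1ℚ
  P*R≡1 k = trans (cong (_* R k) (sym (powQ-fromℤ L k)))
                  (powQ-inverse (recip-inverseʳ (fromℤ L) (fromℤ-≢0 L≢0)) k)

^-mono-∣ : ∀ {m n} k → m ∣ n → m ℕ.^ k ∣ n ℕ.^ k
^-mono-∣ zero    m∣n = ∣-refl
^-mono-∣ (suc k) m∣n = *-pres-∣ m∣n (^-mono-∣ k m∣n)

prime∤⇒∤^ : ∀ {p m} → Prime p → ¬ p ∣ m → ∀ k → ¬ p ∣ m ℕ.^ k
prime∤⇒∤^ pp p∤m zero    p∣1 with ∣1⇒≡1 p∣1 | prime⇒nonTrivial pp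
... | refl | ()
prime∤⇒∤^ {m = m} pp p∤m (suc k) p∣m^[1+k] with euclidsLemma m (m ℕ.^ k) pp p∣m^[1+k]
... | inj₁ p∣m   = p∤m p∣m
... | inj₂ p∣m^k = prime∤⇒∤^ pp p∤m k p∣m^k

p^n∣m*x⇒p^n∣x : ∀ {p m} → Prime p → ¬ p ∣ m → ∀ n {x} → p ℕ.^ n ∣ m ℕ.* x → p ℕ.^ n ∣ x
p^n∣m*x⇒p^n∣x pp p∤m zero {x} _ = 1∣ x
p^n∣m*x⇒p^n∣x {p} {m} pp p∤m (suc n) {x} p^[1+n]∣mx
  with euclidsLemma m x pp (∣-trans (m∣m*n (p ℕ.^ n)) p^[1+n]∣mx)
... | inj₁ p∣m = contradiction p∣m p∤m
... | inj₂ (divides q refl) =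
  subst (p ℕ.^ suc n ∣_) (ℕP.*-comm p q) (*-monoʳ-∣ p (p^n∣m*x⇒p^n∣x pp p∤m n p^n∣mq))
  where
  instance _ = prime⇒nonZero pp
  p^n∣mq : p ℕ.^ n ∣ m ℕ.* q
  p^n∣mq = *-cancelˡ-∣ p (subst (p ℕ.* p ℕ.^ n ∣_) (ℕ*.x∙yz≈z∙xy m q p) p^[1+n]∣mx)

n<m^n : ∀ {m} → 1 < m → ∀ n → n < m ℕ.^ n
n<m^n 1<m zero    = s≤s z≤n
n<m^n {m} 1<m (suc n) = begin-strict
  suc n                   ≤⟨ n<m^n 1<m n ⟩
  m ℕ.^ n                 <⟨ ℕP.m<m+n (m ℕ.^ n) (ℕP.≤-<-trans z≤n (n<m^n 1<m n)) ⟩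
  m ℕ.^ n ℕ.+ m ℕ.^ n     ≡⟨ cong (m ℕ.^ n ℕ.+_) (ℕP.+-identityʳ (m ℕ.^ n)) ⟨
  2 ℕ.* m ℕ.^ n           ≤⟨ ℕP.*-monoˡ-≤ (m ℕ.^ n) 1<m ⟩
  m ℕ.* m ℕ.^ n           ∎
  where open ℕP.≤-Reasoning

p^[1+n]∣n⇒n≡0 : ∀ {p} → Prime p → ∀ n → p ℕ.^ suc n ∣ n → n ≡ 0
p^[1+n]∣n⇒n≡0 pp zero    _ = refl
p^[1+n]∣n⇒n≡0 {p} pp n@(suc _) p^[1+n]∣n = contradiction n<n (ℕP.<-irrefl refl)
  where
  instance _ = prime⇒nonZero pp
  n<n : n < n
  n<n = ℕP.<-≤-trans (n<m^n (ℕ.nonTrivial⇒n>1 p {{prime⇒nonTrivial pp}}) n)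
          (ℕP.≤-trans (ℕP.m≤n*m (p ℕ.^ n) p) (∣⇒≤ p^[1+n]∣n))

divisible-by-all-powers⇒≡0 : ∀ {p a d x} → Prime p → p ∣ a → ¬ p ∣ d →
  (∀ n → Σ ℕ λ k → a ℕ.^ n ∣ d ℕ.^ k ℕ.* x) → x ≡ 0
divisible-by-all-powers⇒≡0 {p} {a} {d} {x} pp p∣a p∤d divisible with divisible (suc x)
... | k , a^[1+x]∣d^kx = p^[1+n]∣n⇒n≡0 pp x
  (p^n∣m*x⇒p^n∣x pp (prime∤⇒∤^ pp p∤d k) (suc x) (∣-trans (^-mono-∣ (suc x) p∣a) a^[1+x]∣d^kx))

∣i^n∣≡∣i∣^n : ∀ i n → ℤ.∣ i ℤ.^ n ∣ ≡ ℤ.∣ i ∣ ℕ.^ n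
∣i^n∣≡∣i∣^n i zero    = refl
∣i^n∣≡∣i∣^n i (suc n) = trans (ℤP.abs-* i (i ℤ.^ n)) (cong (ℤ.∣ i ∣ ℕ.*_) (∣i^n∣≡∣i∣^n i n))

divisible-in-ℤ[1/]-by-all-powers⇒≡0 : ∀ {p α δ x} → Prime p → p ∣ ℤ.∣ α ∣ → ¬ p ∣ ℤ.∣ δ ∣ →
  (∀ n → Σ ℚ λ y → y ∈ℤ[1/ δ ] × fromℤ (α ℤ.^ n) * y ≡ x) → x ≡ 0ℚ
divisible-in-ℤ[1/]-by-all-powers⇒≡0 {p} {α} {δ} {x} pp p∣α p∤δ divisible =
  ℚP.↥p≡0⇒p≡0 x (ℤP.∣i∣≡0⇒i≡0 (divisible-by-all-powers⇒≡0 pp p∣α p∤δ numerator-divisible))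
  where
  open ≡-Reasoning
  numerator-divisible : ∀ n → Σ ℕ λ k → ℤ.∣ α ∣ ℕ.^ n ∣ ℤ.∣ δ ∣ ℕ.^ k ℕ.* ℤ.∣ ℚ.↥ x ∣
  numerator-divisible n with divisible n
  ... | y , (k , z , Δy≡z) , Ay≡x = k , divides ℤ.∣ z ℤ.* ℚ.↧ x ∣ (begin
    ℤ.∣ δ ∣ ℕ.^ k ℕ.* ℤ.∣ ℚ.↥ x ∣          ≡⟨ cong (ℕ._* ℤ.∣ ℚ.↥ x ∣) (∣i^n∣≡∣i∣^n δ k) ⟨
    ℤ.∣ δ ℤ.^ k ∣ ℕ.* ℤ.∣ ℚ.↥ x ∣          ≡⟨ ℤP.abs-* (δ ℤ.^ k) (ℚ.↥ x) ⟨
    ℤ.∣ δ ℤ.^ k ℤ.* ℚ.↥ x ∣                ≡⟨ cong ℤ.∣_∣ in-ℤ ⟩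
    ℤ.∣ α ℤ.^ n ℤ.* (z ℤ.* ℚ.↧ x) ∣        ≡⟨ ℤP.abs-* (α ℤ.^ n) (z ℤ.* ℚ.↧ x) ⟩
    ℤ.∣ α ℤ.^ n ∣ ℕ.* ℤ.∣ z ℤ.* ℚ.↧ x ∣    ≡⟨ cong (ℕ._* ℤ.∣ z ℤ.* ℚ.↧ x ∣) (∣i^n∣≡∣i∣^n α n) ⟩
    ℤ.∣ α ∣ ℕ.^ n ℕ.* ℤ.∣ z ℤ.* ℚ.↧ x ∣    ≡⟨ ℕP.*-comm (ℤ.∣ α ∣ ℕ.^ n) _ ⟩
    ℤ.∣ z ℤ.* ℚ.↧ x ∣ ℕ.* ℤ.∣ α ∣ ℕ.^ n    ∎)
    where
    Δ A F : ℚ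
    Δ = fromℤ (δ ℤ.^ k)
    A = fromℤ (α ℤ.^ n)
    F = fromℤ (ℚ.↧ x)
    in-ℤ : δ ℤ.^ k ℤ.* ℚ.↥ x ≡ α ℤ.^ n ℤ.* (z ℤ.* ℚ.↧ x)
    in-ℤ = fromℤ-injective (begin
      fromℤ (δ ℤ.^ k ℤ.* ℚ.↥ x)           ≡⟨ fromℤ-* (δ ℤ.^ k) (ℚ.↥ x) ⟩
      Δ * fromℤ (ℚ.↥ x)                    ≡⟨ cong (Δ *_) (*-↧≡↥ x) ⟨
      Δ * (x * F)                          ≡⟨ cong (λ t → Δ * (t * F)) Ay≡x ⟨
      Δ * ((A * y) * F)                    ≡⟨ rearrange Δ A y F ⟩
      A * ((Δ * y) * F)                    ≡⟨ cong (λ t → A * (t * F)) Δy≡z ⟩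
      A * (fromℤ z * F)                    ≡⟨ cong (A *_) (fromℤ-* z (ℚ.↧ x)) ⟨
      A * fromℤ (z ℤ.* ℚ.↧ x)              ≡⟨ fromℤ-* (α ℤ.^ n) (z ℤ.* ℚ.↧ x) ⟨
      fromℤ (α ℤ.^ n ℤ.* (z ℤ.* ℚ.↧ x))    ∎)
      where
      rearrange : ∀ Δ A y F → Δ * ((A * y) * F) ≡ A * ((Δ * y) * F)
      rearrange = RingSolver.solve-∀ ℚ-ring

module _ (n : ℕ) where

  prime∣product-filter⇒∣ : ∀ {q} → Prime q → ∀ xs →
    q ∣ product (filter (λ p → prime? p ×-dec (p ∣? n)) xs) → q ∣ n
  prime∣product-filter⇒∣ qp [] q∣1 with ∣1⇒≡1 q∣1 | prime⇒nonTrivial qp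
  ... | refl | ()
  prime∣product-filter⇒∣ qp (x ∷ xs) q∣Π with prime? x | x ∣? n
  ... | no _  | _     = prime∣product-filter⇒∣ qp xs q∣Π
  ... | yes _ | no _  = prime∣product-filter⇒∣ qp xs q∣Π
  ... | yes _ | yes x∣n with euclidsLemma x _ qp q∣Π
  ...   | inj₁ q∣x = ∣-trans q∣x x∣n
  ...   | inj₂ q∣Π′ = prime∣product-filter⇒∣ qp xs q∣Π′

  prime∣⇒∣product-filter : ∀ {q} → Prime q → q ∣ n → ∀ {xs} → q ∈ xs →
    q ∣ product (filter (λ p → prime? p ×-dec (p ∣? n)) xs)
  prime∣⇒∣product-filter {q} qp q∣n {x ∷ xs} q∈ with prime? x | x ∣? n | q∈
  ... | no ¬px  | _       | here refl  = contradiction qp ¬px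
  ... | yes _   | no x∤n  | here refl  = contradiction q∣n x∤n
  ... | yes _   | yes _   | here refl  = m∣m*n _
  ... | no _    | _       | there q∈′ = prime∣⇒∣product-filter qp q∣n q∈′
  ... | yes _   | no _    | there q∈′ = prime∣⇒∣product-filter qp q∣n q∈′
  ... | yes _   | yes _   | there q∈′ = ∣n⇒∣m*n x (prime∣⇒∣product-filter qp q∣n q∈′)

prime∣rad⇒∣ : ∀ {q} n → Prime q → q ∣ radℕ n → q ∣ n
prime∣rad⇒∣ n qp = prime∣product-filter⇒∣ n qp (upTo (suc n))

prime∣⇒∣rad : ∀ {q} n → .{{ℕ.NonZero n}} → Prime q → q ∣ n → q ∣ radℕ n
prime∣⇒∣rad n qp q∣n = prime∣⇒∣product-filter n qp q∣n (∈-upTo⁺ (s≤s (∣⇒≤ q∣n)))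

product-primes∣^length : ∀ {m ps} → All Prime ps → (∀ {q} → Prime q → q ∣ product ps → q ∣ m) →
  product ps ∣ m ℕ.^ length ps
product-primes∣^length [] _ = ∣-refl
product-primes∣^length {ps = p ∷ ps} (pp ∷ pps) primes∣m =
  *-pres-∣ (primes∣m pp (m∣m*n _)) (product-primes∣^length pps (λ qp q∣Π → primes∣m qp (∣n⇒∣m*n p q∣Π)))

prime-factors⊆⇒∣^ : ∀ {n m} → .{{ℕ.NonZero n}} → (∀ {q} → Prime q → q ∣ n → q ∣ m) →
  Σ ℕ λ j → n ∣ m ℕ.^ j
prime-factors⊆⇒∣^ {n} {m} primes∣m =
  length factors , subst (_∣ m ℕ.^ length factors) (sym isFactorisation)
    (product-primes∣^length factorsPrime (λ qp q∣Π → primes∣m qp (subst (_ ∣_) (sym isFactorisation) q∣Π)))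
  where open PrimeFactorisation (factorise n)

rad∣rad⇒prime∣ : ∀ m n → .{{ℕ.NonZero m}} → radℕ m ∣ radℕ n → ∀ {q} → Prime q → q ∣ m → q ∣ n
rad∣rad⇒prime∣ m n rad∣rad qp q∣m = prime∣rad⇒∣ n qp (∣-trans (prime∣⇒∣rad m qp q∣m) rad∣rad)

∣∣-nonZero : ∀ {i} → i ≢ + 0 → ℕ.NonZero ℤ.∣ i ∣
∣∣-nonZero i≢0 = ℕ.≢-nonZero (λ ∣i∣≡0 → i≢0 (ℤP.∣i∣≡0⇒i≡0 ∣i∣≡0))

rad∣rad⇒∣^ : ∀ i j → i ≢ + 0 → rad i ∣ rad j → Σ ℕ λ k → i ℤS.∣ j ℤ.^ k
rad∣rad⇒∣^ i j i≢0 rad∣rad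
  with prime-factors⊆⇒∣^ {{∣∣-nonZero i≢0}} (rad∣rad⇒prime∣ ℤ.∣ i ∣ ℤ.∣ j ∣ {{∣∣-nonZero i≢0}} rad∣rad)
... | k , ∣i∣∣∣j∣^k = k , ℤS.∣ᵤ⇒∣ (subst (ℤ.∣ i ∣ ∣_) (sym (∣i^n∣≡∣i∣^n j k)) ∣i∣∣∣j∣^k)

trace-det-divisible⇒charPoly≡x² : ∀ {p} A → p ∣ ℤ.∣ trZ A ∣ → p ∣ ℤ.∣ detZ A ∣ →
  QuadCongMod p (charPoly A) xSquared
trace-det-divisible⇒charPoly≡x² {p} A p∣tr p∣det =
  subst (λ t → p ∣ ℤ.∣ t ∣) (sym (ℤP.+-identityʳ (detZ A))) p∣det ,
  subst (λ t → p ∣ ℤ.∣ t ∣) (sym (ℤP.+-identityʳ (ℤ.- trZ A)))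
    (subst (p ∣_) (sym (ℤP.∣-i∣≡∣i∣ (trZ A))) p∣tr) ,
  p ℕD.∣0

detZ-upper : ∀ α β δ → detZ (mat α β (+ 0) δ) ≡ α ℤ.* δ
detZ-upper α β δ = trans (cong (λ t → α ℤ.* δ ℤ.- t) (ℤP.*-zeroʳ β)) (ℤP.+-identityʳ (α ℤ.* δ))

P′-upper⇒prime∣α∤δ : ∀ α β δ → P'NonEmpty (mat α β (+ 0) δ) →
  (∀ {q} → Prime q → q ∣ ℤ.∣ δ ∣ → q ∣ ℤ.∣ α ∣) → Σ ℕ λ p → Prime p × p ∣ ℤ.∣ α ∣ × ¬ p ∣ ℤ.∣ δ ∣
P′-upper⇒prime∣α∤δ α β δ (p , pp , p∣det , charPoly≢x²) δ-primes∣α = p , pp , p∣α , p∤δ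
  where
  p∣αδ : p ∣ ℤ.∣ α ∣ ℕ.* ℤ.∣ δ ∣
  p∣αδ = subst (p ∣_) (trans (cong ℤ.∣_∣ (detZ-upper α β δ)) (ℤP.abs-* α δ)) p∣det
  p∣α : p ∣ ℤ.∣ α ∣
  p∣α with euclidsLemma ℤ.∣ α ∣ ℤ.∣ δ ∣ pp p∣αδ
  ... | inj₁ p∣α = p∣α
  ... | inj₂ p∣δ = δ-primes∣α pp p∣δ
  p∤δ : ¬ p ∣ ℤ.∣ δ ∣
  p∤δ p∣δ = charPoly≢x² (trace-det-divisible⇒charPoly≡x² (mat α β (+ 0) δ) p∣α+δ p∣det)
    where
    p∣α+δ : p ∣ ℤ.∣ α ℤ.+ δ ∣
    p∣α+δ = ℤS.∣⇒∣ᵤ (ℤS.∣m∣n⇒∣m+n (ℤS.∣ᵤ⇒∣ {+ p} {α} p∣α) (ℤS.∣ᵤ⇒∣ {+ p} {δ} p∣δ))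

*M-·-assoc : ∀ m n w → (m *M n) · w ≡ m · (n · w)
*M-·-assoc (mat a b c d) (mat a′ b′ c′ d′) (x , y) =
  cong₂ _,_ (rearrange a b a′ b′ c′ d′ x y) (rearrange c d a′ b′ c′ d′ x y)
  where
  rearrange : ∀ a b a′ b′ c′ d′ x y →
    (a * a′ + b * c′) * x + (a * b′ + b * d′) * y ≡ a * (a′ * x + b′ * y) + b * (c′ * x + d′ * y)
  rearrange = RingSolver.solve-∀ ℚ-ring

idM-· : ∀ w → idM · w ≡ w
idM-· (x , y) = cong₂ _,_ (left x y) (right x y)
  where
  left : ∀ x y → 1ℚ * x + 0ℚ * y ≡ x
  left = RingSolver.solve-∀ ℚ-ring
  right : ∀ x y → 0ℚ * x + 1ℚ * y ≡ y
  right = RingSolver.solve-∀ ℚ-ring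

invM-· : ∀ m w → detQ m ≢ 0ℚ → invM m · (m · w) ≡ w
invM-· m@(mat a b c d) (x , y) det≢0 = cong₂ _,_
  (trans (left a b c d r x y) (trans (cong (_* x) det*r≡1) (ℚP.*-identityˡ x)))
  (trans (right a b c d r x y) (trans (cong (_* y) det*r≡1) (ℚP.*-identityˡ y)))
  where
  r : ℚ
  r = recip (detQ m)
  det*r≡1 : detQ m * r ≡ 1ℚ
  det*r≡1 = recip-inverseʳ (detQ m) det≢0
  left : ∀ a b c d r x y →
    (r * d) * (a * x + b * y) + (r * - b) * (c * x + d * y) ≡ ((a * d + - (b * c)) * r) * x
  left = RingSolver.solve-∀ ℚ-ring
  right : ∀ a b c d r x y →
    (r * - c) * (a * x + b * y) + (r * a) * (c * x + d * y) ≡ ((a * d + - (b * c)) * r) * y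
  right = RingSolver.solve-∀ ℚ-ring

·-e₁-multiple : ∀ m s → m · (s , 0ℚ) ≡ (a m * s , c m * s)
·-e₁-multiple (mat a b c d) s = cong₂ _,_ (column a b) (column c d)
  where
  column : ∀ x y → x * s + y * 0ℚ ≡ x * s
  column x y = trans (cong (_+_ (x * s)) (ℚP.*-zeroʳ y)) (ℚP.+-identityʳ (x * s))

·-e₁ : ∀ m → m · (1ℚ , 0ℚ) ≡ (a m , c m)
·-e₁ m = trans (·-e₁-multiple m 1ℚ) (cong₂ _,_ (ℚP.*-identityʳ (a m)) (ℚP.*-identityʳ (c m)))

·-e₂ : ∀ m → m · (0ℚ , 1ℚ) ≡ (b m , d m)
·-e₂ (mat a b c d) = cong₂ _,_ (column a b) (column c d)
  where
  column : ∀ x y → x * 0ℚ + y * 1ℚ ≡ y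
  column = RingSolver.solve-∀ ℚ-ring

c≡0⇒c*x+q≡q : ∀ {c} → c ≡ 0ℚ → ∀ x q → c * x + q ≡ q
c≡0⇒c*x+q≡q refl x q = trans (cong (_+ q) (ℚP.*-zeroˡ x)) (ℚP.+-identityˡ q)

powN-·-e₁ : ∀ m → c m ≡ 0ℚ → ∀ n → powN m n · (1ℚ , 0ℚ) ≡ (powQ (a m) n , 0ℚ)
powN-·-e₁ m c≡0 zero    = refl
powN-·-e₁ m c≡0 (suc n) = begin
  (m *M powN m n) · (1ℚ , 0ℚ)    ≡⟨ *M-·-assoc m (powN m n) (1ℚ , 0ℚ) ⟩
  m · (powN m n · (1ℚ , 0ℚ))     ≡⟨ cong (m ·_) (powN-·-e₁ m c≡0 n) ⟩
  m · (powQ (a m) n , 0ℚ)        ≡⟨ ·-e₁-multiple m (powQ (a m) n) ⟩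
  (powQ (a m) (suc n) , c m * powQ (a m) n)
                                 ≡⟨ cong (powQ (a m) (suc n) ,_) c*aⁿ≡0 ⟩
  (powQ (a m) (suc n) , 0ℚ)      ∎
  where
  open ≡-Reasoning
  c*aⁿ≡0 : c m * powQ (a m) n ≡ 0ℚ
  c*aⁿ≡0 = trans (cong (_* powQ (a m) n) c≡0) (ℚP.*-zeroˡ (powQ (a m) n))

-- With D = det A, Triangular D λ₂ is the paper's set of upper triangular T ∈ M₂(ℛ) with z ∈ ℤ[1/λ₂].
record Triangular (D δ : ℤ) (m : M2 ℚ) : Set where
  constructor triangular
  field
    c≡0 : c m ≡ 0ℚ
    a∈  : a m ∈ℤ[1/ D ]
    b∈  : b m ∈ℤ[1/ D ]
    d∈  : d m ∈ℤ[1/ δ ]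

Triangular-ℤ : ∀ {D δ} x y z → Triangular D δ (embM (mat x y (+ 0) z))
Triangular-ℤ x y z = triangular refl (fromℤ∈ℤ[1/] _ x) (fromℤ∈ℤ[1/] _ y) (fromℤ∈ℤ[1/] _ z)

infix 4 _∈ℤ[1/_]×ℤ[1/_]

_∈ℤ[1/_]×ℤ[1/_] : V2 ℚ → ℤ → ℤ → Set
w ∈ℤ[1/ D ]×ℤ[1/ δ ] = proj₁ w ∈ℤ[1/ D ] × proj₂ w ∈ℤ[1/ δ ]

ι : V2 ℤ → V2 ℚ
ι (x , y) = fromℤ x , fromℤ y

ι∈ℤ[1/]×ℤ[1/] : ∀ D δ z → ι z ∈ℤ[1/ D ]×ℤ[1/ δ ]
ι∈ℤ[1/]×ℤ[1/] D δ (x , y) = fromℤ∈ℤ[1/] D x , fromℤ∈ℤ[1/] δ y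

module _ {D δ : ℤ} (δ⊆D : ℤ[1/ δ ]⊆ℤ[1/ D ]) where

  Triangular-· : ∀ {m w} → Triangular D δ m → w ∈ℤ[1/ D ]×ℤ[1/ δ ] → m · w ∈ℤ[1/ D ]×ℤ[1/ δ ]
  Triangular-· {m} {x , y} (triangular c≡0 a∈ b∈ d∈) (x∈ , y∈) =
    ∈ℤ[1/]-+ (∈ℤ[1/]-* a∈ x∈) (∈ℤ[1/]-* b∈ (δ⊆D y∈)) ,
    subst (_∈ℤ[1/ δ ]) (sym (c≡0⇒c*x+q≡q c≡0 x (d m * y))) (∈ℤ[1/]-* d∈ y∈)

  Triangular-*M : ∀ {m n} → Triangular D δ m → Triangular D δ n → Triangular D δ (m *M n)
  Triangular-*M {m} {n} (triangular c≡0 a∈ b∈ d∈) (triangular c′≡0 a′∈ b′∈ d′∈) = triangular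
    (trans (c≡0⇒c*x+q≡q c≡0 (a n) (d m * c n)) (trans (cong (d m *_) c′≡0) (ℚP.*-zeroʳ (d m))))
    (∈ℤ[1/]-+ (∈ℤ[1/]-* a∈ a′∈) (∈ℤ[1/]-* b∈ (subst (_∈ℤ[1/ D ]) (sym c′≡0) (fromℤ∈ℤ[1/] D (+ 0)))))
    (∈ℤ[1/]-+ (∈ℤ[1/]-* a∈ b′∈) (∈ℤ[1/]-* b∈ (δ⊆D d′∈)))
    (subst (_∈ℤ[1/ δ ]) (sym (c≡0⇒c*x+q≡q c≡0 (b n) (d m * d n))) (∈ℤ[1/]-* d∈ d′∈))

  Triangular-powN : ∀ {m} → Triangular D δ m → ∀ n → Triangular D δ (powN m n)
  Triangular-powN m∈ zero    = Triangular-ℤ (+ 1) (+ 0) (+ 1)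
  Triangular-powN m∈ (suc n) = Triangular-*M m∈ (Triangular-powN m∈ n)

E₁₁ E₁₂ : M2 ℚ
E₁₁ = mat 1ℚ 0ℚ 0ℚ 0ℚ
E₁₂ = mat 0ℚ 1ℚ 0ℚ 0ℚ

E₁₁E₁₂≢E₁₂E₁₁ : E₁₁ *M E₁₂ ≢ E₁₂ *M E₁₁
E₁₁E₁₂≢E₁₂E₁₁ ()

E₁₂-commutes⇒d≡a : ∀ m → E₁₂ *M m ≡ m *M E₁₂ → d m ≡ a m
E₁₂-commutes⇒d≡a (mat a b c d) commutes = begin
  d                       ≡⟨ left b d ⟨
  0ℚ * b + 1ℚ * d         ≡⟨ cong M2.b commutes ⟩
  a * 1ℚ + b * 0ℚ         ≡⟨ right a b ⟩
  a                       ∎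
  where
  open ≡-Reasoning
  left : ∀ b d → 0ℚ * b + 1ℚ * d ≡ d
  left = RingSolver.solve-∀ ℚ-ring
  right : ∀ a b → a * 1ℚ + b * 0ℚ ≡ a
  right = RingSolver.solve-∀ ℚ-ring

EndStructure : ℤ → M2 ℚ → Set
EndStructure λ₂ A =
  ((T : M2 ℚ) → IsEnd A T ⇔
    (c T ≡ 0ℚ × InZInv (detQ A) (a T) × InZInv (detQ A) (b T)
      × InZInv (detQ A) (d T) × InZInv (fromℤ λ₂) (d T)))
  × ¬ ((S T : M2 ℚ) → IsEnd A S → IsEnd A T → S *M T ≡ T *M S)
  × ¬ ((T : M2 ℚ) → IsEnd A T → T *M A ≡ A *M T)

module UpperTriangular (α β δ : ℤ) (αδ≢0 : α ℤ.* δ ≢ + 0) where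

  Q : M2 ℚ
  Q = embM (mat α β (+ 0) δ)

  detQ-Q : detQ Q ≡ fromℤ (α ℤ.* δ)
  detQ-Q = trans (drop-b (fromℤ α) (fromℤ δ) (fromℤ β)) (sym (fromℤ-* α δ))
    where
    drop-b : ∀ a d b → a * d + - (b * 0ℚ) ≡ a * d
    drop-b = RingSolver.solve-∀ ℚ-ring

  private
    r : ℚ
    r = recip (detQ Q)

    αδr≡1 : fromℤ (α ℤ.* δ) * r ≡ 1ℚ
    αδr≡1 = subst (λ t → t * r ≡ 1ℚ) detQ-Q
              (recip-inverseʳ (detQ Q) (subst (_≢ 0ℚ) (sym detQ-Q) (fromℤ-≢0 αδ≢0)))

    r∈ : r ∈ℤ[1/ α ℤ.* δ ]
    r∈ = 1 , + 1 , trans (cong (λ t → fromℤ t * r) (ℤP.*-identityʳ (α ℤ.* δ))) αδr≡1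

    δrα≡1 : fromℤ (δ ℤ.^ 1) * (r * fromℤ α) ≡ fromℤ (+ 1)
    δrα≡1 = begin
      fromℤ (δ ℤ.^ 1) * (r * fromℤ α)   ≡⟨ cong (λ t → fromℤ t * (r * fromℤ α)) (ℤP.*-identityʳ δ) ⟩
      fromℤ δ * (r * fromℤ α)           ≡⟨ ℚ*.x∙yz≈zx∙y (fromℤ δ) r (fromℤ α) ⟩
      (fromℤ α * fromℤ δ) * r           ≡⟨ cong (_* r) (fromℤ-* α δ) ⟨
      fromℤ (α ℤ.* δ) * r               ≡⟨ αδr≡1 ⟩
      1ℚ                                ∎
      where open ≡-Reasoning

    Q⁻¹₁₁*α≡1 : a (invM Q) * fromℤ α ≡ 1ℚ
    Q⁻¹₁₁*α≡1 = begin
      (r * fromℤ δ) * fromℤ α   ≡⟨ ℚ*.xy∙z≈zy∙x r (fromℤ δ) (fromℤ α) ⟩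
      (fromℤ α * fromℤ δ) * r   ≡⟨ cong (_* r) (fromℤ-* α δ) ⟨
      fromℤ (α ℤ.* δ) * r       ≡⟨ αδr≡1 ⟩
      1ℚ                        ∎
      where open ≡-Reasoning

  δ⊆αδ : ℤ[1/ δ ]⊆ℤ[1/ α ℤ.* δ ]
  δ⊆αδ = ∣^⇒ℤ[1/]⊆ 1 (ℤS.divides α (ℤP.*-identityʳ (α ℤ.* δ)))

  Triangular-Q : Triangular (α ℤ.* δ) δ Q
  Triangular-Q = Triangular-ℤ α β δ

  Triangular-Q⁻¹ : Triangular (α ℤ.* δ) δ (invM Q)
  Triangular-Q⁻¹ = triangular
    (ℚP.*-zeroʳ r)
    (∈ℤ[1/]-* r∈ (fromℤ∈ℤ[1/] _ δ))
    (∈ℤ[1/]-* r∈ (subst (_∈ℤ[1/ α ℤ.* δ ]) (fromℤ-‿ β) (fromℤ∈ℤ[1/] _ (ℤ.- β))))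
    (1 , + 1 , δrα≡1)

  Triangular-powZ : ∀ k → Triangular (α ℤ.* δ) δ (powZ Q k)
  Triangular-powZ (+ n)    = Triangular-powN δ⊆αδ Triangular-Q n
  Triangular-powZ -[1+ n ] = Triangular-powN δ⊆αδ Triangular-Q⁻¹ (suc n)

  InG⇒∈ℤ[1/]×ℤ[1/] : ∀ {w} → InG Q w → w ∈ℤ[1/ α ℤ.* δ ]×ℤ[1/ δ ]
  InG⇒∈ℤ[1/]×ℤ[1/] (k , z , refl) =
    Triangular-· δ⊆αδ (Triangular-powZ k) (ι∈ℤ[1/]×ℤ[1/] (α ℤ.* δ) δ z)

  InverseOrbit : V2 ℚ → Set
  InverseOrbit w = Σ ℕ λ N → Σ (V2 ℤ) λ z → w ≡ powN (invM Q) N · ι z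

  InverseOrbit⇒InG : ∀ {w} → InverseOrbit w → InG Q w
  InverseOrbit⇒InG (zero  , z , w≡) = + 0 , z , w≡
  InverseOrbit⇒InG (suc N , z , w≡) = -[1+ N ] , z , w≡

  InverseOrbit-Q⁻¹ : ∀ {w} → InverseOrbit (Q · w) → InverseOrbit w
  InverseOrbit-Q⁻¹ {w} (N , z , Qw≡) = suc N , z , (begin
    w                                    ≡⟨ invM-· Q w detQ≢0 ⟨
    invM Q · (Q · w)                     ≡⟨ cong (invM Q ·_) Qw≡ ⟩
    invM Q · (powN (invM Q) N · ι z)     ≡⟨ *M-·-assoc (invM Q) (powN (invM Q) N) (ι z) ⟨
    powN (invM Q) (suc N) · ι z          ∎)
    where
    open ≡-Reasoning
    detQ≢0 : detQ Q ≢ 0ℚ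
    detQ≢0 = subst (_≢ 0ℚ) (sym detQ-Q) (fromℤ-≢0 αδ≢0)

  ℤ[1/α]×ℤ⊆InverseOrbit : ∀ k {x} z y → fromℤ (α ℤ.^ k) * x ≡ fromℤ z → InverseOrbit (x , fromℤ y)
  ℤ[1/α]×ℤ⊆InverseOrbit zero {x} z y x≡z =
    0 , (z , y) , trans (cong (_, fromℤ y) (trans (sym (ℚP.*-identityˡ x)) x≡z)) (sym (idM-· (ι (z , y))))
  ℤ[1/α]×ℤ⊆InverseOrbit (suc k) {x} z y Ax≡z = InverseOrbit-Q⁻¹
    (subst (λ t → InverseOrbit (_ , t)) (sym second)
      (ℤ[1/α]×ℤ⊆InverseOrbit k (z ℤ.+ α ℤ.^ k ℤ.* β ℤ.* y) (δ ℤ.* y) first))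
    where
    open ≡-Reasoning
    P : ℚ
    P = fromℤ (α ℤ.^ k)
    second : 0ℚ * x + fromℤ δ * fromℤ y ≡ fromℤ (δ ℤ.* y)
    second = trans (c≡0⇒c*x+q≡q refl x _) (sym (fromℤ-* δ y))
    first : P * (fromℤ α * x + fromℤ β * fromℤ y) ≡ fromℤ (z ℤ.+ α ℤ.^ k ℤ.* β ℤ.* y)
    first = begin
      P * (fromℤ α * x + fromℤ β * fromℤ y)           ≡⟨ distribute P (fromℤ α) x (fromℤ β) (fromℤ y) ⟩
      (fromℤ α * P) * x + (P * fromℤ β) * fromℤ y     ≡⟨ cong₂ (λ s t → s * x + t * fromℤ y)
                                                            (fromℤ-* α (α ℤ.^ k)) (fromℤ-* (α ℤ.^ k) β) ⟨
      fromℤ (α ℤ.^ suc k) * x + fromℤ (α ℤ.^ k ℤ.* β) * fromℤ y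
                                                       ≡⟨ cong₂ _+_ Ax≡z (sym (fromℤ-* (α ℤ.^ k ℤ.* β) y)) ⟩
      fromℤ z + fromℤ (α ℤ.^ k ℤ.* β ℤ.* y)           ≡⟨ fromℤ-+ z (α ℤ.^ k ℤ.* β ℤ.* y) ⟨
      fromℤ (z ℤ.+ α ℤ.^ k ℤ.* β ℤ.* y)               ∎
      where
      distribute : ∀ P a x b y → P * (a * x + b * y) ≡ (a * P) * x + (P * b) * y
      distribute = RingSolver.solve-∀ ℚ-ring

  module _ (δ⊆α : ℤ[1/ δ ]⊆ℤ[1/ α ]) where

    ℤ[1/α]×ℤ[1/δ]⊆InverseOrbit : ∀ k {x y} z → x ∈ℤ[1/ α ] → fromℤ (δ ℤ.^ k) * y ≡ fromℤ z →
      InverseOrbit (x , y)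
    ℤ[1/α]×ℤ[1/δ]⊆InverseOrbit zero {y = y} z (l , x′ , Ax≡x′) y≡z =
      subst (λ t → InverseOrbit (_ , t)) (sym (trans (sym (ℚP.*-identityˡ y)) y≡z))
        (ℤ[1/α]×ℤ⊆InverseOrbit l x′ z Ax≡x′)
    ℤ[1/α]×ℤ[1/δ]⊆InverseOrbit (suc k) {x} {y} z x∈ Δy≡z = InverseOrbit-Q⁻¹
      (ℤ[1/α]×ℤ[1/δ]⊆InverseOrbit k z
        (∈ℤ[1/]-+ (∈ℤ[1/]-* (fromℤ∈ℤ[1/] α α) x∈) (∈ℤ[1/]-* (fromℤ∈ℤ[1/] α β) (δ⊆α (suc k , z , Δy≡z))))
        second)
      where
      open ≡-Reasoning
      P : ℚ
      P = fromℤ (δ ℤ.^ k)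
      second : P * (0ℚ * x + fromℤ δ * y) ≡ fromℤ z
      second = begin
        P * (0ℚ * x + fromℤ δ * y)   ≡⟨ cong (P *_) (c≡0⇒c*x+q≡q refl x (fromℤ δ * y)) ⟩
        P * (fromℤ δ * y)            ≡⟨ ℚ*.x∙yz≈yx∙z P (fromℤ δ) y ⟩
        (fromℤ δ * P) * y            ≡⟨ cong (_* y) (fromℤ-* δ (δ ℤ.^ k)) ⟨
        fromℤ (δ ℤ.^ suc k) * y      ≡⟨ Δy≡z ⟩
        fromℤ z                      ∎

    ∈ℤ[1/]×ℤ[1/]⇒InG : ∀ {w} → w ∈ℤ[1/ α ]×ℤ[1/ δ ] → InG Q w
    ∈ℤ[1/]×ℤ[1/]⇒InG (x∈ , k , z , Δy≡z) = InverseOrbit⇒InG (ℤ[1/α]×ℤ[1/δ]⊆InverseOrbit k z x∈ Δy≡z)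

  IsEnd⇒Triangular : ∀ {p T} → Prime p → p ∣ ℤ.∣ α ∣ → ¬ p ∣ ℤ.∣ δ ∣ → IsEnd Q T →
    Triangular (α ℤ.* δ) δ T
  IsEnd⇒Triangular {p} {T} pp p∣α p∤δ T∈End = triangular
    (divisible-in-ℤ[1/]-by-all-powers⇒≡0 pp p∣α p∤δ c-divisible)
    (proj₁ Te₁∈) (proj₁ Te₂∈) (proj₂ Te₂∈)
    where
    image : ∀ {w} → InG Q w → T · w ∈ℤ[1/ α ℤ.* δ ]×ℤ[1/ δ ]
    image w∈G = InG⇒∈ℤ[1/]×ℤ[1/] (T∈End _ w∈G)
    Te₁∈ : (a T , c T) ∈ℤ[1/ α ℤ.* δ ]×ℤ[1/ δ ]
    Te₁∈ = subst (_∈ℤ[1/ α ℤ.* δ ]×ℤ[1/ δ ]) (·-e₁ T) (image (+ 0 , (+ 1 , + 0) , refl))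
    Te₂∈ : (b T , d T) ∈ℤ[1/ α ℤ.* δ ]×ℤ[1/ δ ]
    Te₂∈ = subst (_∈ℤ[1/ α ℤ.* δ ]×ℤ[1/ δ ]) (·-e₂ T) (image (+ 0 , (+ 0 , + 1) , refl))
    s : ℚ
    s = a (invM Q)
    -- s = α⁻¹, and Q⁻ⁿ e₁ = (sⁿ, 0) lies in G_Q, so T maps it to (a sⁿ, c sⁿ).
    c-divisible : ∀ n → Σ ℚ λ y → y ∈ℤ[1/ δ ] × fromℤ (α ℤ.^ n) * y ≡ c T
    c-divisible n = c T * powQ s n ,
      proj₂ (subst (_∈ℤ[1/ α ℤ.* δ ]×ℤ[1/ δ ]) (·-e₁-multiple T (powQ s n))
        (image (InverseOrbit⇒InG (n , (+ 1 , + 0) , sym (powN-·-e₁ (invM Q) (ℚP.*-zeroʳ r) n))))) ,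
      (begin
        fromℤ (α ℤ.^ n) * (c T * powQ s n)         ≡⟨ ℚ*.x∙yz≈y∙zx (fromℤ (α ℤ.^ n)) (c T) (powQ s n) ⟩
        c T * (powQ s n * fromℤ (α ℤ.^ n))         ≡⟨ cong (λ t → c T * (powQ s n * t)) (powQ-fromℤ α n) ⟨
        c T * (powQ s n * powQ (fromℤ α) n)        ≡⟨ cong (c T *_) (powQ-inverse Q⁻¹₁₁*α≡1 n) ⟩
        c T * 1ℚ                                   ≡⟨ ℚP.*-identityʳ (c T) ⟩
        c T                                        ∎)
      where open ≡-Reasoning

  module _ (j : ℕ) (δ∣α^j : δ ℤS.∣ α ℤ.^ j) where

    Triangular⇒IsEnd : ∀ {T} → Triangular (α ℤ.* δ) δ T → IsEnd Q T
    Triangular⇒IsEnd {T} T∈ w w∈G =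
      ∈ℤ[1/]×ℤ[1/]⇒InG δ⊆α {T · w} (map₁ αδ⊆α (Triangular-· δ⊆αδ T∈ (InG⇒∈ℤ[1/]×ℤ[1/] w∈G)))
      where
      δ⊆α : ℤ[1/ δ ]⊆ℤ[1/ α ]
      δ⊆α = ∣^⇒ℤ[1/]⊆ j δ∣α^j
      αδ⊆α : ℤ[1/ α ℤ.* δ ]⊆ℤ[1/ α ]
      αδ⊆α = ∣^⇒ℤ[1/]⊆ (suc j) (ℤS.*-monoʳ-∣ α δ∣α^j)

    IsEnd⇔Triangular : ∀ {p} → Prime p → p ∣ ℤ.∣ α ∣ → ¬ p ∣ ℤ.∣ δ ∣ →
      ∀ T → IsEnd Q T ⇔ Triangular (α ℤ.* δ) δ T
    IsEnd⇔Triangular pp p∣α p∤δ T = mk⇔ (IsEnd⇒Triangular pp p∣α p∤δ) Triangular⇒IsEnd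

  Triangular⇔InZInv : ∀ T → Triangular (α ℤ.* δ) δ T ⇔
    (c T ≡ 0ℚ × InZInv (detQ Q) (a T) × InZInv (detQ Q) (b T)
      × InZInv (detQ Q) (d T) × InZInv (fromℤ δ) (d T))
  Triangular⇔InZInv T = mk⇔
    (λ (triangular c≡0 a∈ b∈ d∈) → c≡0 , to-det a∈ , to-det b∈ , to-det (δ⊆αδ d∈) , to-δ d∈)
    (λ (c≡0 , a∈ , b∈ , _ , d∈) → triangular c≡0 (from-det a∈) (from-det b∈) (from (⇔δ _) d∈))
    where
    open Equivalence using (to; from)
    δ≢0 : δ ≢ + 0
    δ≢0 δ≡0 = αδ≢0 (trans (cong (α ℤ.*_) δ≡0) (ℤP.*-zeroʳ α))
    ⇔det : ∀ q → q ∈ℤ[1/ α ℤ.* δ ] ⇔ InZInv (fromℤ (α ℤ.* δ)) q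
    ⇔det = ∈ℤ[1/]⇔InZInv αδ≢0
    ⇔δ : ∀ q → q ∈ℤ[1/ δ ] ⇔ InZInv (fromℤ δ) q
    ⇔δ = ∈ℤ[1/]⇔InZInv δ≢0
    to-det : ∀ {q} → q ∈ℤ[1/ α ℤ.* δ ] → InZInv (detQ Q) q
    to-det q∈ = subst (λ t → InZInv t _) (sym detQ-Q) (to (⇔det _) q∈)
    from-det : ∀ {q} → InZInv (detQ Q) q → q ∈ℤ[1/ α ℤ.* δ ]
    from-det q∈ = from (⇔det _) (subst (λ t → InZInv t _) detQ-Q q∈)
    to-δ : ∀ {q} → q ∈ℤ[1/ δ ] → InZInv (fromℤ δ) q
    to-δ q∈ = to (⇔δ _) q∈

  EndStructure-Q : (Σ ℕ λ p → Prime p × p ∣ ℤ.∣ α ∣ × ¬ p ∣ ℤ.∣ δ ∣) → (Σ ℕ λ j → δ ℤS.∣ α ℤ.^ j) →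
    EndStructure δ Q
  EndStructure-Q (p , pp , p∣α , p∤δ) (j , δ∣α^j) = IsEnd⇔InZInv , noncommutative , ⊈centraliser
    where
    IsEnd⇔InZInv : ∀ T → IsEnd Q T ⇔
      (c T ≡ 0ℚ × InZInv (detQ Q) (a T) × InZInv (detQ Q) (b T)
        × InZInv (detQ Q) (d T) × InZInv (fromℤ δ) (d T))
    IsEnd⇔InZInv T = Triangular⇔InZInv T ⇔-∘ IsEnd⇔Triangular j δ∣α^j pp p∣α p∤δ T
    E₁₁-End : IsEnd Q E₁₁
    E₁₁-End = Triangular⇒IsEnd j δ∣α^j (Triangular-ℤ (+ 1) (+ 0) (+ 0))
    E₁₂-End : IsEnd Q E₁₂
    E₁₂-End = Triangular⇒IsEnd j δ∣α^j (Triangular-ℤ (+ 0) (+ 1) (+ 0))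
    noncommutative : ¬ (∀ S T → IsEnd Q S → IsEnd Q T → S *M T ≡ T *M S)
    noncommutative commutative = E₁₁E₁₂≢E₁₂E₁₁ (commutative E₁₁ E₁₂ E₁₁-End E₁₂-End)
    ⊈centraliser : ¬ (∀ T → IsEnd Q T → T *M Q ≡ Q *M T)
    ⊈centraliser centralises = p∤δ (subst (λ t → p ∣ ℤ.∣ t ∣) α≡δ p∣α)
      where
      α≡δ : α ≡ δ
      α≡δ = fromℤ-injective (sym (E₁₂-commutes⇒d≡a Q (centralises E₁₂ E₁₂-End)))

upper-conjugate-diagonal : ∀ λ₁ λ₂ u v → v ≢ 0ℚ →
  let A = mat 1ℚ u 0ℚ v *M mat λ₁ 0ℚ 0ℚ λ₂ *M invM (mat 1ℚ u 0ℚ v)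
  in a A ≡ λ₁ × c A ≡ 0ℚ × d A ≡ λ₂
upper-conjugate-diagonal λ₁ λ₂ u v v≢0 =
  trans (a-entry λ₁ λ₂ u v r) (trans (cong (λ₁ *_) v*r≡1) (ℚP.*-identityʳ λ₁)) ,
  c-entry λ₁ λ₂ u v r ,
  trans (d-entry λ₁ λ₂ u v r) (trans (cong (λ₂ *_) v*r≡1) (ℚP.*-identityʳ λ₂))
  where
  M : M2 ℚ
  M = mat 1ℚ u 0ℚ v
  r : ℚ
  r = recip (detQ M)
  detM≡v : detQ M ≡ v
  detM≡v = det u v
    where
    det : ∀ u v → 1ℚ * v + - (u * 0ℚ) ≡ v
    det = RingSolver.solve-∀ ℚ-ring
  v*r≡1 : v * r ≡ 1ℚ
  v*r≡1 = subst (λ t → t * r ≡ 1ℚ) detM≡v (recip-inverseʳ (detQ M) (subst (_≢ 0ℚ) (sym detM≡v) v≢0))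
  a-entry : ∀ λ₁ λ₂ u v r → (1ℚ * λ₁ + u * 0ℚ) * (r * v) + (1ℚ * 0ℚ + u * λ₂) * (r * - 0ℚ) ≡ λ₁ * (v * r)
  a-entry = RingSolver.solve-∀ ℚ-ring
  c-entry : ∀ λ₁ λ₂ u v r → (0ℚ * λ₁ + v * 0ℚ) * (r * v) + (0ℚ * 0ℚ + v * λ₂) * (r * - 0ℚ) ≡ 0ℚ
  c-entry = RingSolver.solve-∀ ℚ-ring
  d-entry : ∀ λ₁ λ₂ u v r → (0ℚ * λ₁ + v * 0ℚ) * (r * - u) + (0ℚ * 0ℚ + v * λ₂) * (r * 1ℚ) ≡ λ₂ * (v * r)
  d-entry = RingSolver.solve-∀ ℚ-ring

upper-triangular-EndStructure : ∀ λ₁ λ₂ A → a A ≡ λ₁ → c A ≡ + 0 → d A ≡ λ₂ → detZ A ≢ + 0 →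
  P'NonEmpty A → rad λ₂ ℕD.∣ rad λ₁ → EndStructure λ₂ (embM A)
upper-triangular-EndStructure λ₁ λ₂ (mat _ β _ _) refl refl refl det≢0 P′ rad∣rad =
  UpperTriangular.EndStructure-Q λ₁ β λ₂ λ₁λ₂≢0
    (P′-upper⇒prime∣α∤δ λ₁ β λ₂ P′ (rad∣rad⇒prime∣ ℤ.∣ λ₂ ∣ ℤ.∣ λ₁ ∣ {{∣∣-nonZero λ₂≢0}} rad∣rad))
    (rad∣rad⇒∣^ λ₂ λ₁ λ₂≢0 rad∣rad)
  where
  λ₁λ₂≢0 : λ₁ ℤ.* λ₂ ≢ + 0
  λ₁λ₂≢0 = subst (_≢ + 0) (detZ-upper λ₁ β λ₂) det≢0
  λ₂≢0 : λ₂ ≢ + 0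
  λ₂≢0 λ₂≡0 = λ₁λ₂≢0 (trans (cong (λ₁ ℤ.*_) λ₂≡0) (ℤP.*-zeroʳ λ₁))

conjugate-EndStructure : ∀ λ₁ λ₂ Aℤ {A} → embM Aℤ ≡ A →
  a A ≡ fromℤ λ₁ × c A ≡ 0ℚ × d A ≡ fromℤ λ₂ → detZ Aℤ ≢ + 0 → P'NonEmpty Aℤ →
  rad λ₂ ℕD.∣ rad λ₁ → EndStructure λ₂ A
conjugate-EndStructure λ₁ λ₂ Aℤ refl (a≡λ₁ , c≡0 , d≡λ₂) = upper-triangular-EndStructure λ₁ λ₂ Aℤ
  (fromℤ-injective a≡λ₁) (fromℤ-injective c≡0) (fromℤ-injective d≡λ₂)

theorem3p7 : (l₁ l₂ u v : ℤ) → ℤG.gcd u v ≡ + 1 → v ℤD.∣ (l₁ ℤ.- l₂) → v ≢ + 0 →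
  let Λ = mat (fromℤ l₁) 0ℚ 0ℚ (fromℤ l₂)
      M = mat (fromℤ (+ 1)) (fromℤ u) 0ℚ (fromℤ v)
      A = M *M Λ *M invM M
  in (Aℤ : M2 ℤ) → embM Aℤ ≡ A → detZ Aℤ ≢ + 0 → P'NonEmpty Aℤ →
     rad l₂ ℕD.∣ rad l₁ →
     ((T : M2 ℚ) → IsEnd A T ⇔
        (c T ≡ 0ℚ × InZInv (detQ A) (a T) × InZInv (detQ A) (b T)
          × InZInv (detQ A) (d T) × InZInv (fromℤ l₂) (d T)))
     × ¬ ((S T : M2 ℚ) → IsEnd A S → IsEnd A T → S *M T ≡ T *M S)
     × ¬ ((T : M2 ℚ) → IsEnd A T → T *M A ≡ A *M T)
-- gcd u v ≡ 1 and v ∣ λ₁ − λ₂ only serve to make A integral, which Aℤ already witnesses.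
theorem3p7 l₁ l₂ u v _ _ v≢0 Aℤ A≡ = conjugate-EndStructure l₁ l₂ Aℤ A≡
  (upper-conjugate-diagonal (fromℤ l₁) (fromℤ l₂) (fromℤ u) (fromℤ v) (fromℤ-≢0 v≢0))
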